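{- Let $u,v\ge 1$ be integers and let $z$ and $z'$ be distinct $(u,v)$-orphans. Then the vertex sets of the trees $\mathcal{T}^{(u,v)}(z)$ and $\mathcal{T}^{(u,v)}(z')$ are disjoint.
   Context: For integers $u,v\ge 1$ and a positive rational number $z$ in lowest terms, the $(u,v)$-Calkin–Wilf tree $\mathcal{T}^{(u,v)}(z)$ is the infinite binary tree with root $z$ in which every vertex $w$ has left child $w/(uw+1)$ and right child $w+v$. A $(u,v)$-orphan is a positive rational number that is not a child of any vertex of any $(u,v)$-Calkin–Wilf tree; equivalently, the $(u,v)$-orphans are exactly the positive rationals $x$ with $1/u\le x\le v$. -}

module Defs where

open import Data.Nat using (ℕ; suc; NonZero)
import Data.Nat as ℕ
open import Data.Integer using (ℤ; ∣_∣; +_)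
open import Data.Rational using (ℚ; _+_; _/_; Positive)
import Data.Rational as ℚ
open ℚ.ℚ using (numerator; denominatorℕ)
open import Data.Product using (_×_)
open import Relation.Binary.PropositionalEquality using (_≡_; _≢_)

-- Left child of w in the (u,v)-Calkin–Wilf tree: w/(uw+1).
-- Writing w = a/b in lowest terms (b ≥ 1), w/(uw+1) = a/(ua+b); this is
-- exact for every rational w ≥ 0 (in particular all positive w), and the
-- denominator b + u·|a| is manifestly nonzero.
leftChild : (u : ℕ) → ℚ → ℚ
leftChild u w = numerator w / (denominatorℕ w ℕ.+ u ℕ.* ∣ numerator w ∣)

rightChild : (v : ℕ) → ℚ → ℚ
rightChild v w = w + (+ v / 1)

data InTree (u v : ℕ) (z : ℚ) : ℚ → Set where
  root  : InTree u v z z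
  left  : ∀ {w} → InTree u v z w → InTree u v z (leftChild u w)
  right : ∀ {w} → InTree u v z w → InTree u v z (rightChild v w)

-- (u,v)-orphan: a positive rational which is not a child of any vertex of
-- any (u,v)-Calkin–Wilf tree (the vertices of such trees are exactly the
-- positive rationals, since roots are arbitrary positive rationals).
Orphan : (u v : ℕ) → ℚ → Set
Orphan u v x =
  Positive x ×
  (∀ (w : ℚ) → Positive w → (x ≢ leftChild u w) × (x ≢ rightChild v w))

{-# OPTIONS --safe #-}
module Submission where

open import Defs
open import Data.Nat using (ℕ; _≥_)
open import Data.Rational using (ℚ)
open import Relation.Binary.PropositionalEquality using (_≢_)
open import Relation.Nullary using (¬_)
open import Data.Product using (_×_)

open import Data.Empty using (⊥-elim)
open import Data.Product using (_,_; proj₁; proj₂)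
open import Data.Nat as ℕ using (suc; s≤s)
import Data.Nat.Properties as ℕ
import Data.Integer.Properties as ℤ
open import Data.Integer as ℤ using (+_; +[1+_]; +<+; +≤+)
open import Data.Rational using (mkℚ; 1ℚ; Positive; _<_; _≤_; _/_)
open import Data.Rational.Properties
  using (toℚᵘ-fromℚᵘ; toℚᵘ-cancel-<; toℚᵘ-cancel-≤; toℚᵘ-injective; normalize-injective-≃;
         normalize-pos; normalize-nonNeg; pos+nonNeg⇒pos; positive⁻¹; +-mono-<-≤;
         <-trans; <-irrefl; +-0-group)
import Data.Rational.Unnormalised as ℚᵘ
import Data.Rational.Unnormalised.Properties as ℚᵘ
open import Algebra.Properties.Group +-0-group using (∙-cancelʳ)
open import Algebra.Properties.CommutativeSemigroup ℕ.*-commutativeSemigroup using (x∙yz≈z∙yx)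
open import Relation.Binary.PropositionalEquality using (_≡_; refl; sym; subst₂; cong; module ≡-Reasoning)

+/suc<1 : ∀ {m n} → m ℕ.≤ n → + m / suc n < 1ℚ
+/suc<1 {m} {n} m≤n = toℚᵘ-cancel-<
  (ℚᵘ.<-respˡ-≃ (ℚᵘ.≃-sym (toℚᵘ-fromℚᵘ (ℚᵘ.mkℚᵘ (+ m) n)))
    (ℚᵘ.*<* (subst₂ ℤ._<_ (sym (ℤ.*-identityʳ (+ m))) (sym (ℤ.*-identityˡ (+ suc n))) (+<+ (s≤s m≤n)))))

1≤+/1 : ∀ {m} → m ≥ 1 → 1ℚ ≤ + m / 1
1≤+/1 {m} m≥1 = toℚᵘ-cancel-≤
  (ℚᵘ.≤-respʳ-≃ (ℚᵘ.≃-sym (toℚᵘ-fromℚᵘ (ℚᵘ.mkℚᵘ (+ m) 0)))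
    (ℚᵘ.*≤* (subst₂ ℤ._≤_ refl (sym (ℤ.*-identityʳ (+ m))) (+≤+ m≥1))))

leftChild-positive : ∀ u w → Positive w → Positive (leftChild u w)
leftChild-positive u (mkℚ +[1+ n ] d _) _ = normalize-pos (suc n) (suc d ℕ.+ u ℕ.* suc n)

rightChild-positive : ∀ v w → Positive w → Positive (rightChild v w)
rightChild-positive v w w>0 = pos+nonNeg⇒pos w {{w>0}} (+ v / 1) {{normalize-nonNeg v 1}}

InTree⇒Positive : ∀ {u v z x} → Positive z → InTree u v z x → Positive x
InTree⇒Positive z>0 root = z>0
InTree⇒Positive {u} z>0 (left {w} t) = leftChild-positive u w (InTree⇒Positive z>0 t)
InTree⇒Positive {v = v} z>0 (right {w} t) = rightChild-positive v w (InTree⇒Positive z>0 t)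

leftChild<1 : ∀ {u} → u ≥ 1 → ∀ w → Positive w → leftChild u w < 1ℚ
leftChild<1 {suc u} _ (mkℚ +[1+ n ] d _) _ =
  +/suc<1 (ℕ.≤-trans (ℕ.m≤m+n (suc n) (u ℕ.* suc n)) (ℕ.m≤n+m _ d))

1<rightChild : ∀ {v} → v ≥ 1 → ∀ w → Positive w → 1ℚ < rightChild v w
1<rightChild v≥1 w w>0 = +-mono-<-≤ (positive⁻¹ w {{w>0}}) (1≤+/1 v≥1)

leftChild≢rightChild : ∀ {u v} → u ≥ 1 → v ≥ 1 → ∀ w w′ → Positive w → Positive w′ →
                       leftChild u w ≢ rightChild v w′
leftChild≢rightChild u≥1 v≥1 w w′ w>0 w′>0 eq =
  <-irrefl eq (<-trans (leftChild<1 u≥1 w w>0) (1<rightChild v≥1 w′ w′>0))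

leftChild-injective : ∀ u w w′ → Positive w → Positive w′ →
                      leftChild u w ≡ leftChild u w′ → w ≡ w′
leftChild-injective u (mkℚ +[1+ n ] d _) (mkℚ +[1+ n′ ] d′ _) _ _ eq =
  toℚᵘ-injective (ℚᵘ.*≡* (cong +_ (ℕ.+-cancelʳ-≡ (a ℕ.* (u ℕ.* a′)) _ _ cross)))
  where
  open ≡-Reasoning
  a = suc n
  a′ = suc n′
  cross : a ℕ.* suc d′ ℕ.+ a ℕ.* (u ℕ.* a′) ≡ a′ ℕ.* suc d ℕ.+ a ℕ.* (u ℕ.* a′)
  cross = begin
    a ℕ.* suc d′ ℕ.+ a ℕ.* (u ℕ.* a′)   ≡⟨ ℕ.*-distribˡ-+ a (suc d′) (u ℕ.* a′) ⟨
    a ℕ.* (suc d′ ℕ.+ u ℕ.* a′)         ≡⟨ normalize-injective-≃ a a′ _ _ eq ⟩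
    a′ ℕ.* (suc d ℕ.+ u ℕ.* a)          ≡⟨ ℕ.*-distribˡ-+ a′ (suc d) (u ℕ.* a) ⟩
    a′ ℕ.* suc d ℕ.+ a′ ℕ.* (u ℕ.* a)   ≡⟨ cong (a′ ℕ.* suc d ℕ.+_) (x∙yz≈z∙yx a′ u a) ⟩
    a′ ℕ.* suc d ℕ.+ a ℕ.* (u ℕ.* a′)   ∎

rightChild-injective : ∀ v w w′ → rightChild v w ≡ rightChild v w′ → w ≡ w′
rightChild-injective v w w′ = ∙-cancelʳ (+ v / 1) w w′

-- Descending both paths in lockstep: the last steps must be of the same kind
-- (left children are < 1 < right children), and both child maps are injective.
InTree-orphan-root-unique : ∀ {u v z z′} → u ≥ 1 → v ≥ 1 → Orphan u v z → Orphan u v z′ →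
                            ∀ {x x′} → InTree u v z x → InTree u v z′ x′ → x ≡ x′ → z ≡ z′
InTree-orphan-root-unique {u} {v} {z} {z′} u≥1 v≥1 (z>0 , z-orphan) (z′>0 , z′-orphan) = same
  where
  pos : ∀ {x} → InTree u v z x → Positive x
  pos = InTree⇒Positive z>0
  pos′ : ∀ {x} → InTree u v z′ x → Positive x
  pos′ = InTree⇒Positive z′>0
  same : ∀ {x x′} → InTree u v z x → InTree u v z′ x′ → x ≡ x′ → z ≡ z′
  same root root e = e
  same root (left {w} t′) e = ⊥-elim (proj₁ (z-orphan w (pos′ t′)) e)
  same root (right {w} t′) e = ⊥-elim (proj₂ (z-orphan w (pos′ t′)) e)
  same (left {w} t) root e = ⊥-elim (proj₁ (z′-orphan w (pos t)) (sym e))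
  same (right {w} t) root e = ⊥-elim (proj₂ (z′-orphan w (pos t)) (sym e))
  same (left {w} t) (left {w′} t′) e = same t t′ (leftChild-injective u w w′ (pos t) (pos′ t′) e)
  same (right {w} t) (right {w′} t′) e = same t t′ (rightChild-injective v w w′ e)
  same (left {w} t) (right {w′} t′) e = ⊥-elim (leftChild≢rightChild u≥1 v≥1 w w′ (pos t) (pos′ t′) e)
  same (right {w} t) (left {w′} t′) e =
    ⊥-elim (leftChild≢rightChild u≥1 v≥1 w′ w (pos′ t′) (pos t) (sym e))

lemma2p1 : (u v : ℕ) → u ≥ 1 → v ≥ 1 → (z z′ : ℚ) →
    Orphan u v z → Orphan u v z′ → z ≢ z′ →
    (x : ℚ) → ¬ (InTree u v z x × InTree u v z′ x)
lemma2p1 u v u≥1 v≥1 z z′ oz oz′ z≢z′ x (t , t′) =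
  z≢z′ (InTree-orphan-root-unique u≥1 v≥1 oz oz′ t t′ refl)
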